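{- Let $n>2$ be an integer and let $S\subseteq\mathbb{F}_2^n$ be nonempty. Then $$|\Delta(S)|\ \ge\ \frac{\log|S|}{2\log n}.$$
   Context: For $x,y\in\mathbb{F}_2^n$, $d_H(x,y)=\#\{i:x_i\neq y_i\}$ is the Hamming distance, and $\Delta(S)=\{d_H(x,y):x,y\in S\}$ (pairs with $x=y$ allowed). The base of the logarithm is irrelevant since the bound is a ratio of logarithms. -}

module Defs where

open import Data.Nat using (ℕ; zero; suc)
open import Data.Bool using (Bool; true; false)
open import Data.Vec using (Vec; []; _∷_)
open import Data.List using (List)
open import Data.List.Membership.Propositional using (_∈_)
open import Data.Product using (∃; _×_)
open import Relation.Binary.PropositionalEquality using (_≡_)

-- Elements of F_2^n are represented as Vec Bool n.

dH : ∀ {n} → Vec Bool n → Vec Bool n → ℕ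
dH [] [] = zero
dH (true ∷ xs) (true ∷ ys) = dH xs ys
dH (false ∷ xs) (false ∷ ys) = dH xs ys
dH (true ∷ xs) (false ∷ ys) = suc (dH xs ys)
dH (false ∷ xs) (true ∷ ys) = suc (dH xs ys)

-- d ∈ Δ(S): d is the Hamming distance of some pair x, y ∈ S (x = y allowed).
InΔ : ∀ {n} → List (Vec Bool n) → ℕ → Set
InΔ S d = ∃ λ x → ∃ λ y → x ∈ S × y ∈ S × dH x y ≡ d

-- Fix a prime p > n.  For a ∈ S the polynomial
-- f_a(z) = ∏_{d ∈ D, d ≠ 0} (dH(a, z) − d) is divisible by p at every b ∈ S other than a, but not
-- at a.  Since dH(a, z) is a linear form in the 1 + 2n affine literals (1, z_i, 1 − z_i), f_a(z) is
-- the pairing of a tensor F_a with (1 + 2n)^|D| entries and the |D|-th tensor power of the literal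
-- vector of z.  Hence the F_a are linearly independent over F_p, so |S| ≤ (1 + 2n)^|D| ≤ n^(2|D|)
-- (as n ≥ 3).  Independence is shown by counting: the p^|S| combinations Σ t_a F_a with 0 ≤ t_a < p
-- are pairwise distinct modulo p.

module Submission where

open import Defs
open import Data.Nat using (ℕ; zero; suc; _+_; _*_; _∸_; _^_; _≤_; _<_; _≰_; z≤n; s≤s; z<s; _!;
  NonZero; _%_; _/_; nonTrivial⇒n>1; >-nonZero)
open import Data.Nat.Properties
open import Data.Nat.DivMod using (_mod_; m≡m%n+[m/n]*n; %-distribˡ-+; %-distribˡ-*; %-remove-+ʳ)
open import Data.Nat.Divisibility using (_∣_; _∤_; divides; _∣0; ∣m∣n⇒∣m+n; ∣n⇒∣m*n; ∣m+n∣m⇒∣n;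
  m∣m*n; ∣-trans; ∣-reflexive; >⇒∤; m≤n⇒m!∣n!)
open import Data.Nat.Primality using (Prime; euclidsLemma; prime⇒nonZero; prime⇒nonTrivial)
open import Data.Nat.Primality.Factorisation using (factorise)
open import Data.Nat.ListAction using (product)
open import Data.Nat.ListAction.Properties using (∈⇒∣product)
open import Data.Bool using (Bool; true; false; not)
open import Data.Vec using (Vec; []; _∷_)
import Data.Vec as Vec
open import Data.Vec.Functional using (Vector)
import Data.Vec.Functional as V
open import Data.Fin using (Fin; zero; suc; toℕ; _↑ˡ_; _↑ʳ_; combine; quotient; remainder; punchIn;
  funToFin; finToFun)
open import Data.Fin.Properties using (remQuot-combine; toℕ-fromℕ<; toℕ<n; toℕ-injective; injective⇒≤;
  punchInᵢ≢i; funToFin-finToFin; finToFun-funToFin)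
open import Data.List using (List; []; _∷_; length; map; lookup)
open import Data.List.Properties using (map-cong)
open import Data.List.Membership.Propositional using (_∈_)
open import Data.List.Membership.Propositional.Properties using (∈-map⁺; ∈-lookup)
open import Data.List.Relation.Unary.All as All using (All; []; _∷_)
import Data.List.Relation.Unary.All.Properties as Allₚ
open import Data.List.Relation.Unary.AllPairs using (_∷_)
open import Data.List.Relation.Unary.Unique.Propositional using (Unique)
open import Data.Product using (∃-syntax; _×_; _,_)
open import Data.Sum using (inj₁; inj₂)
open import Function using (_∘_)
open import Function.Bundles using (_⇔_; Equivalence)
open import Relation.Nullary using (contradiction)
open import Relation.Binary.PropositionalEquality
open import Algebra.Properties.Semiring.Sum +-*-semiring

infixl 7 _·_ _⊗_
infixr 8 _⊗^_

_·_ : ∀ {N} → Vector ℕ N → Vector ℕ N → ℕ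
_·_ {N} u v = ∑[ i < N ] (u i * v i)

·-linearˡ : ∀ {s N} (t : Vector ℕ s) (v : Fin s → Vector ℕ N) (w : Vector ℕ N) →
            (λ c → ∑[ i < s ] (t i * v i c)) · w ≡ ∑[ i < s ] (t i * (v i · w))
·-linearˡ {s} {N} t v w = begin
  ∑[ c < N ] (∑[ i < s ] (t i * v i c) * w c)
    ≡⟨ sum-cong-≗ (λ c → *-distribʳ-sum (w c) (λ i → t i * v i c)) ⟩
  ∑[ c < N ] ∑[ i < s ] (t i * v i c * w c)
    ≡⟨ ∑-comm (λ c i → t i * v i c * w c) ⟩
  ∑[ i < s ] ∑[ c < N ] (t i * v i c * w c)
    ≡⟨ sum-cong-≗ (λ i → sum-cong-≗ (λ c → *-assoc (t i) (v i c) (w c))) ⟩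
  ∑[ i < s ] ∑[ c < N ] (t i * (v i c * w c))
    ≡⟨ sum-cong-≗ (λ i → *-distribˡ-sum (t i) (λ c → v i c * w c)) ⟨
  ∑[ i < s ] (t i * (v i · w))
    ∎
  where open ≡-Reasoning

∑-splitAt : ∀ m {n} (f : Vector ℕ (m + n)) →
      ∑[ k < m + n ] f k ≡ ∑[ i < m ] f (i ↑ˡ n) + ∑[ j < n ] f (m ↑ʳ j)
∑-splitAt zero    f = refl
∑-splitAt (suc m) f = trans (cong (f zero +_) (∑-splitAt m (f ∘ suc))) (sym (+-assoc (f zero) _ _))

∑-combine : ∀ m {n} (f : Vector ℕ (m * n)) →
            ∑[ k < m * n ] f k ≡ ∑[ i < m ] ∑[ j < n ] f (combine i j)
∑-combine zero        f = refl
∑-combine (suc m) {n} f =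
  trans (∑-splitAt n f) (cong (∑[ j < n ] f (combine {suc m} zero j) +_) (∑-combine m (f ∘ (n ↑ʳ_))))

_⊗_ : ∀ {m n} → Vector ℕ m → Vector ℕ n → Vector ℕ (m * n)
_⊗_ {m} {n} u v k = u (quotient {m} n k) * v (remainder {m} n k)

⊗-combine : ∀ {m n} (u : Vector ℕ m) (v : Vector ℕ n) i j → (u ⊗ v) (combine i j) ≡ u i * v j
⊗-combine {m} {n} u v i j = cong (λ (q , r) → u q * v r) (remQuot-combine {m} {n} i j)

⊗-· : ∀ {m n} (u x : Vector ℕ m) (v y : Vector ℕ n) → (u ⊗ v) · (x ⊗ y) ≡ (u · x) * (v · y)
⊗-· {m} {n} u x v y = begin
  ∑[ k < m * n ] ((u ⊗ v) k * (x ⊗ y) k)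
    ≡⟨ ∑-combine m _ ⟩
  ∑[ i < m ] ∑[ j < n ] ((u ⊗ v) (combine i j) * (x ⊗ y) (combine i j))
    ≡⟨ sum-cong-≗ (λ i → sum-cong-≗ (λ j → cong₂ _*_ (⊗-combine u v i j) (⊗-combine x y i j))) ⟩
  ∑[ i < m ] ∑[ j < n ] ((u i * v j) * (x i * y j))
    ≡⟨ sum-cong-≗ (λ i → sum-cong-≗ (λ j → [m*n]*[o*p]≡[m*o]*[n*p] (u i) (v j) (x i) (y j))) ⟩
  ∑[ i < m ] ∑[ j < n ] ((u i * x i) * (v j * y j))
    ≡⟨ sum-cong-≗ (λ i → *-distribˡ-sum (u i * x i) (λ j → v j * y j)) ⟨
  ∑[ i < m ] ((u i * x i) * (v · y))
    ≡⟨ *-distribʳ-sum (v · y) (λ i → u i * x i) ⟨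
  (u · x) * (v · y)
    ∎
  where open ≡-Reasoning

_⊗^_ : ∀ {m} → Vector ℕ m → (k : ℕ) → Vector ℕ (m ^ k)
x ⊗^ zero  = λ _ → 1
x ⊗^ suc k = x ⊗ x ⊗^ k

⨂ : ∀ {A : Set} {m} → (A → Vector ℕ m) → (ds : List A) → Vector ℕ (m ^ length ds)
⨂ F []       = λ _ → 1
⨂ F (d ∷ ds) = F d ⊗ ⨂ F ds

⨂-·-⊗^ : ∀ {A : Set} {m} (F : A → Vector ℕ m) (x : Vector ℕ m) ds →
          ⨂ F ds · x ⊗^ length ds ≡ product (map (λ d → F d · x) ds)
⨂-·-⊗^ F x []       = refl
⨂-·-⊗^ F x (d ∷ ds) = trans (⊗-· (F d) x (⨂ F ds) _) (cong (F d · x *_) (⨂-·-⊗^ F x ds))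

prime⇒>1 : ∀ {p} → Prime p → 1 < p
prime⇒>1 {p} p-prime = nonTrivial⇒n>1 p {{prime⇒nonTrivial p-prime}}

∣-∑ : ∀ {d n} (f : Vector ℕ n) → (∀ i → d ∣ f i) → d ∣ ∑[ i < n ] f i
∣-∑ {d} {zero}  f d∣f = d ∣0
∣-∑ {d} {suc n} f d∣f = ∣m∣n⇒∣m+n (d∣f zero) (∣-∑ (f ∘ suc) (d∣f ∘ suc))

infix 4 _≡_[mod_]

_≡_[mod_] : ℕ → ℕ → (p : ℕ) .{{_ : NonZero p}} → Set
x ≡ y [mod p ] = x % p ≡ y % p

module _ {p : ℕ} .{{_ : NonZero p}} where

  +-cong-mod : ∀ {x y u v} → x ≡ y [mod p ] → u ≡ v [mod p ] → x + u ≡ y + v [mod p ]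
  +-cong-mod {x} {y} {u} {v} x≡y u≡v = begin
    (x + u) % p                ≡⟨ %-distribˡ-+ x u p ⟩
    (x % p + u % p) % p        ≡⟨ cong₂ (λ a b → (a + b) % p) x≡y u≡v ⟩
    (y % p + v % p) % p        ≡⟨ %-distribˡ-+ y v p ⟨
    (y + v) % p                ∎
    where open ≡-Reasoning

  *-congʳ-mod : ∀ {x y} z → x ≡ y [mod p ] → x * z ≡ y * z [mod p ]
  *-congʳ-mod {x} {y} z x≡y = begin
    (x * z) % p                ≡⟨ %-distribˡ-* x z p ⟩
    (x % p * (z % p)) % p      ≡⟨ cong (λ a → (a * (z % p)) % p) x≡y ⟩
    (y % p * (z % p)) % p      ≡⟨ %-distribˡ-* y z p ⟨
    (y * z) % p                ∎
    where open ≡-Reasoning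

  ∑-cong-mod : ∀ {n} {f g : Vector ℕ n} → (∀ i → f i ≡ g i [mod p ]) →
               ∑[ i < n ] f i ≡ ∑[ i < n ] g i [mod p ]
  ∑-cong-mod {zero}  f≡g = refl
  ∑-cong-mod {suc n} f≡g = +-cong-mod (f≡g zero) (∑-cong-mod (f≡g ∘ suc))

  ∑-mod-single : ∀ {n} (f : Vector ℕ n) j → (∀ i → i ≢ j → p ∣ f i) →
                 ∑[ i < n ] f i ≡ f j [mod p ]
  ∑-mod-single {suc n} f j p∣f = trans (cong (_% p) (sum-remove {i = j} f))
    (%-remove-+ʳ (f j) (∣-∑ _ (λ i → p∣f (punchIn j i) (punchInᵢ≢i j i))))

  mod⇒∣∸ : ∀ {x y} → x ≡ y [mod p ] → p ∣ y ∸ x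
  mod⇒∣∸ {x} {y} x≡y = divides (y / p ∸ x / p) (begin
    y ∸ x                                     ≡⟨ cong₂ _∸_ (m≡m%n+[m/n]*n y p) (m≡m%n+[m/n]*n x p) ⟩
    (y % p + y / p * p) ∸ (x % p + x / p * p) ≡⟨ cong (λ r → (y % p + y / p * p) ∸ (r + x / p * p)) x≡y ⟩
    (y % p + y / p * p) ∸ (y % p + x / p * p) ≡⟨ [m+n]∸[m+o]≡n∸o (y % p) _ _ ⟩
    y / p * p ∸ x / p * p                     ≡⟨ *-distribʳ-∸ p (y / p) (x / p) ⟨
    (y / p ∸ x / p) * p                       ∎)
    where open ≡-Reasoning

  *-cancelʳ-mod : ∀ {c x y} → Prime p → p ∤ c → x < p → y < p → x * c ≡ y * c [mod p ] → x ≡ y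
  *-cancelʳ-mod {c} p-prime p∤c x<p y<p xc≡yc =
    ≤-antisym (≤-cancel x<p (sym xc≡yc)) (≤-cancel y<p xc≡yc)
    where
    ≤-cancel : ∀ {x y} → y < p → x * c ≡ y * c [mod p ] → y ≤ x
    ≤-cancel {x} {y} y<p xc≡yc
      with euclidsLemma (y ∸ x) c p-prime (subst (p ∣_) (sym (*-distribʳ-∸ c y x)) (mod⇒∣∸ xc≡yc))
    ... | inj₂ p∣c   = contradiction p∣c p∤c
    ... | inj₁ p∣y∸x = m∸n≡0⇒m≤n (∣∧<⇒≡0 p∣y∸x (≤-<-trans (m∸n≤m y x) y<p))
      where
      ∣∧<⇒≡0 : ∀ {m} → p ∣ m → m < p → m ≡ 0
      ∣∧<⇒≡0 {zero}  _   _   = refl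
      ∣∧<⇒≡0 {suc m} p∣m m<p = contradiction p∣m (>⇒∤ m<p)

funToFin-cong : ∀ {m n} {f g : Fin m → Fin n} → f ≗ g → funToFin f ≡ funToFin g
funToFin-cong {zero}  f≗g = refl
funToFin-cong {suc m} f≗g = cong₂ combine (f≗g zero) (funToFin-cong (f≗g ∘ suc))

≗-injection⇒^≤ : ∀ {p s N} (F : (Fin s → Fin p) → (Fin N → Fin p)) →
                   (∀ {f g} → F f ≗ F g → f ≗ g) → p ^ s ≤ p ^ N
≗-injection⇒^≤ {p} {s} {N} F F-injective = injective⇒≤ {f = funToFin ∘ F ∘ finToFun {p} {s}} injective
  where
  injective : ∀ {k l} → funToFin (F (finToFun {p} {s} k)) ≡ funToFin (F (finToFun l)) → k ≡ l
  injective {k} {l} eq = begin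
    k                              ≡⟨ funToFin-finToFin {s} k ⟨
    funToFin (finToFun {p} {s} k)  ≡⟨ funToFin-cong (F-injective F-eq) ⟩
    funToFin (finToFun {p} {s} l)  ≡⟨ funToFin-finToFin {s} l ⟩
    l                              ∎
    where
    open ≡-Reasoning
    F-eq : F (finToFun {p} {s} k) ≗ F (finToFun l)
    F-eq c = trans (sym (finToFun-funToFin _ c))
                   (trans (cong (λ i → finToFun i c) eq) (finToFun-funToFin _ c))

^-cancelˡ-≤ : ∀ {m n o} → 1 < m → m ^ n ≤ m ^ o → n ≤ o
^-cancelˡ-≤ {m} 1<m mⁿ≤mᵒ = ≮⇒≥ (λ o<n → <⇒≱ (^-monoʳ-< m 1<m o<n) mⁿ≤mᵒ)

biorthogonal⇒≤ : ∀ {p s N} → Prime p → (v w : Fin s → Vector ℕ N) →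
                 (∀ {i j} → i ≢ j → p ∣ v i · w j) → (∀ i → p ∤ v i · w i) → s ≤ N
biorthogonal⇒≤ {p} {s} {N} p-prime v w off-diagonal diagonal =
  ^-cancelˡ-≤ (prime⇒>1 p-prime) (≗-injection⇒^≤ reduce reduce-injective)
  where
  instance
    p≢0 : NonZero p
    p≢0 = prime⇒nonZero p-prime

  combination : (Fin s → Fin p) → Vector ℕ N
  combination t c = ∑[ i < s ] (toℕ (t i) * v i c)

  reduce : (Fin s → Fin p) → Fin N → Fin p
  reduce t c = combination t c mod p

  combination-· : ∀ t j → combination t · w j ≡ toℕ (t j) * (v j · w j) [mod p ]
  combination-· t j = trans (cong (_% p) (·-linearˡ (toℕ ∘ t) v (w j)))
    (∑-mod-single _ j (λ i i≢j → ∣n⇒∣m*n (toℕ (t i)) (off-diagonal i≢j)))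

  reduce-injective : ∀ {t t'} → reduce t ≗ reduce t' → t ≗ t'
  reduce-injective {t} {t'} reduce-t≗t' j =
    toℕ-injective (*-cancelʳ-mod p-prime (diagonal j) (toℕ<n (t j)) (toℕ<n (t' j)) coefficients-≡)
    where
    open ≡-Reasoning
    combinations-≡ : ∀ c → combination t c ≡ combination t' c [mod p ]
    combinations-≡ c = trans (sym (toℕ-fromℕ< _)) (trans (cong toℕ (reduce-t≗t' c)) (toℕ-fromℕ< _))
    coefficients-≡ : toℕ (t j) * (v j · w j) ≡ toℕ (t' j) * (v j · w j) [mod p ]
    coefficients-≡ = begin
      toℕ (t j) * (v j · w j) % p    ≡⟨ combination-· t j ⟨
      combination t · w j % p        ≡⟨ ∑-cong-mod (λ c → *-congʳ-mod {x = combination t c} (w j c) (combinations-≡ c)) ⟩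
      combination t' · w j % p       ≡⟨ combination-· t' j ⟩
      toℕ (t' j) * (v j · w j) % p   ∎

∤-product : ∀ {p xs} → Prime p → All (p ∤_) xs → p ∤ product xs
∤-product p-prime []           = >⇒∤ (prime⇒>1 p-prime)
∤-product p-prime (p∤x ∷ p∤xs) p∣x*xs with euclidsLemma _ _ p-prime p∣x*xs
... | inj₁ p∣x  = p∤x p∣x
... | inj₂ p∣xs = ∤-product p-prime p∤xs p∣xs

∃-prime-divisor : ∀ {m} → 1 < m → ∃[ q ] Prime q × q ∣ m
∃-prime-divisor {suc m} 1<m with factorise (suc m)
... | record { factors = [] ; isFactorisation = m≡1 } = contradiction m≡1 (>⇒≢ 1<m)
... | record { factors = q ∷ qs ; isFactorisation = m≡q*qs ; factorsPrime = q-prime ∷ _ } =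
  q , q-prime , divides (product qs) (trans m≡q*qs (*-comm q (product qs)))

n∣n! : ∀ {n} → 0 < n → n ∣ n !
n∣n! {suc n} _ = m∣m*n (n !)

∃-prime> : ∀ n → ∃[ p ] Prime p × n < p
∃-prime> n with ∃-prime-divisor (+-monoˡ-≤ 1 (1≤n! n))
... | p , p-prime , p∣n!+1 = p , p-prime , ≰⇒> p≰n
  where
  1<p : 1 < p
  1<p = prime⇒>1 p-prime
  p≰n : p ≰ n
  p≰n p≤n = >⇒∤ 1<p (∣m+n∣m⇒∣n p∣n!+1 (∣-trans (n∣n! (<⇒≤ 1<p)) (m≤n⇒m!∣n! p≤n)))

dH-self : ∀ {n} (a : Vec Bool n) → dH a a ≡ 0
dH-self []          = refl
dH-self (true  ∷ a) = dH-self a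
dH-self (false ∷ a) = dH-self a

dH≡0⇒≡ : ∀ {n} {a b : Vec Bool n} → dH a b ≡ 0 → a ≡ b
dH≡0⇒≡ {a = []}        {[]}        _   = refl
dH≡0⇒≡ {a = true  ∷ a} {true  ∷ b} eq = cong (true ∷_) (dH≡0⇒≡ eq)
dH≡0⇒≡ {a = false ∷ a} {false ∷ b} eq = cong (false ∷_) (dH≡0⇒≡ eq)

dH≤n : ∀ {n} (a b : Vec Bool n) → dH a b ≤ n
dH≤n []          []          = z≤n
dH≤n (true  ∷ a) (true  ∷ b) = m≤n⇒m≤1+n (dH≤n a b)
dH≤n (false ∷ a) (false ∷ b) = m≤n⇒m≤1+n (dH≤n a b)
dH≤n (true  ∷ a) (false ∷ b) = s≤s (dH≤n a b)
dH≤n (false ∷ a) (true  ∷ b) = s≤s (dH≤n a b)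

literals : ∀ {n} → Vec Bool n → Vector ℕ (n * 2)
literals []          = V.[]
literals (false ∷ z) = 0 V.∷ 1 V.∷ literals z
literals (true  ∷ z) = 1 V.∷ 0 V.∷ literals z

dH≡literals-· : ∀ {n} (a z : Vec Bool n) → dH a z ≡ literals (Vec.map not a) · literals z
dH≡literals-· []          []          = refl
dH≡literals-· (true  ∷ a) (true  ∷ z) = dH≡literals-· a z
dH≡literals-· (false ∷ a) (false ∷ z) = dH≡literals-· a z
dH≡literals-· (true  ∷ a) (false ∷ z) = cong suc (dH≡literals-· a z)
dH≡literals-· (false ∷ a) (true  ∷ z) = cong suc (dH≡literals-· a z)

point : ∀ {n} → Vec Bool n → Vector ℕ (suc (n * 2))
point z = 1 V.∷ literals z

module _ (p : ℕ) where

  -- For 0 < d ≤ p, factor d h ≡ h − d (mod p).  The distance 0 contributes the constant 1, so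
  -- that f_a does not vanish at a.
  factor : ℕ → ℕ → ℕ
  factor zero    h = 1
  factor (suc e) h = p ∸ suc e + h

  factorForm : ∀ {n} → Vec Bool n → ℕ → Vector ℕ (suc (n * 2))
  factorForm a zero    = 1 V.∷ V.replicate _ 0
  factorForm a (suc e) = p ∸ suc e V.∷ literals (Vec.map not a)

  factorForm-·-point : ∀ {n} (a z : Vec Bool n) d → factorForm a d · point z ≡ factor d (dH a z)
  factorForm-·-point {n} a z zero    = cong suc (sum-replicate-zero (n * 2))
  factorForm-·-point     a z (suc e) =
    cong₂ _+_ (*-identityʳ (p ∸ suc e)) (sym (dH≡literals-· a z))

  form : ∀ {n} → Vec Bool n → (D : List ℕ) → Vector ℕ (suc (n * 2) ^ length D)
  form a = ⨂ (factorForm a)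

  form-·-point : ∀ {n} (a z : Vec Bool n) D →
                 form a D · point z ⊗^ length D ≡ product (map (λ d → factor d (dH a z)) D)
  form-·-point a z D =
    trans (⨂-·-⊗^ (factorForm a) (point z) D) (cong product (map-cong (factorForm-·-point a z) D))

  factor-self : ∀ {d} → 0 < d → d ≤ p → factor d d ≡ p
  factor-self {suc e} _ d≤p = m∸n+n≡m d≤p

  p∤factor-0 : ∀ {d} → Prime p → d < p → p ∤ factor d 0
  p∤factor-0 {zero}  p-prime _   = >⇒∤ (prime⇒>1 p-prime)
  p∤factor-0 {suc e} _       d<p rewrite +-identityʳ (p ∸ suc e) =
    >⇒∤ {{>-nonZero (m<n⇒0<n∸m d<p)}} (∸-monoʳ-< z<s (<⇒≤ d<p))

  p∣form-·-point : ∀ {n} {a b : Vec Bool n} {D} → n < p → dH a b ∈ D → a ≢ b →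
                   p ∣ form a D · point b ⊗^ length D
  p∣form-·-point {n} {a} {b} {D} n<p dH∈D a≢b = subst (p ∣_) (sym (form-·-point a b D))
    (∣-trans (∣-reflexive (sym (factor-self dH>0 (≤-trans (dH≤n a b) (<⇒≤ n<p)))))
             (∈⇒∣product (∈-map⁺ (λ d → factor d (dH a b)) dH∈D)))
    where
    dH>0 : 0 < dH a b
    dH>0 = n≢0⇒n>0 (a≢b ∘ dH≡0⇒≡)

  p∤form-·-point-self : ∀ {n} (a : Vec Bool n) {D} → Prime p → (∀ {d} → d ∈ D → d < p) →
                        p ∤ form a D · point a ⊗^ length D
  p∤form-·-point-self a {D} p-prime D<p p∣ =
    ∤-product p-prime (Allₚ.map⁺ (All.tabulate p∤factor)) (subst (p ∣_) (form-·-point a a D) p∣)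
    where
    p∤factor : ∀ {d} → d ∈ D → p ∤ factor d (dH a a)
    p∤factor d∈D rewrite dH-self a = p∤factor-0 p-prime (D<p d∈D)

lookup-injective : ∀ {A : Set} {xs : List A} → Unique xs → ∀ {i j} → lookup xs i ≡ lookup xs j → i ≡ j
lookup-injective {xs = _ ∷ _} (x∉xs ∷ _)         {zero}  {zero}  eq = refl
lookup-injective {xs = _ ∷ _} (x∉xs ∷ _)         {zero}  {suc j} eq =
  contradiction eq (All.lookup x∉xs (∈-lookup j))
lookup-injective {xs = _ ∷ _} (x∉xs ∷ _)         {suc i} {zero}  eq =
  contradiction (sym eq) (All.lookup x∉xs (∈-lookup i))
lookup-injective {xs = _ ∷ _} (_    ∷ xs-unique) {suc i} {suc j} eq = cong suc (lookup-injective xs-unique eq)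

length≤[1+n*2]^length : ∀ {n p} → Prime p → n < p → {S : List (Vec Bool n)} → Unique S →
                        {D : List ℕ} → (∀ d → (d ∈ D) ⇔ InΔ S d) → length S ≤ suc (n * 2) ^ length D
length≤[1+n*2]^length {n} {p} p-prime n<p {S} S-unique {D} D≡Δ =
  biorthogonal⇒≤ p-prime (λ i → form p (lookup S i) D) (λ j → point (lookup S j) ⊗^ length D)
                 off-diagonal diagonal
  where
  off-diagonal : ∀ {i j} → i ≢ j → p ∣ form p (lookup S i) D · point (lookup S j) ⊗^ length D
  off-diagonal {i} {j} i≢j = p∣form-·-point p n<p
    (Equivalence.from (D≡Δ _) (_ , _ , ∈-lookup i , ∈-lookup j , refl))
    (i≢j ∘ lookup-injective S-unique)
  D<p : ∀ {d} → d ∈ D → d < p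
  D<p d∈D with Equivalence.to (D≡Δ _) d∈D
  ... | x , y , _ , _ , refl = ≤-<-trans (dH≤n x y) n<p
  diagonal : ∀ i → p ∤ form p (lookup S i) D · point (lookup S i) ⊗^ length D
  diagonal i = p∤form-·-point-self p (lookup S i) p-prime D<p

1+n*2≤n*n : ∀ {n} → 2 < n → suc (n * 2) ≤ n * n
1+n*2≤n*n {n} 2<n = begin
  suc (n * 2)  ≤⟨ +-monoˡ-≤ (n * 2) (≤-trans (s≤s z≤n) 2<n) ⟩
  n + n * 2    ≡⟨ *-suc n 2 ⟨
  n * 3        ≤⟨ *-monoʳ-≤ n 2<n ⟩
  n * n        ∎
  where open ≤-Reasoning

lemma3p1 : (n : ℕ) → 2 < n
    → (S : List (Vec Bool n)) → Unique S → S ≢ []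
    → (D : List ℕ) → Unique D → (∀ d → (d ∈ D) ⇔ InΔ S d)
    → length S ≤ n ^ (2 * length D)
lemma3p1 n 2<n S S-unique _ D _ D≡Δ with ∃-prime> n
... | p , p-prime , n<p = begin
  length S                ≤⟨ length≤[1+n*2]^length p-prime n<p S-unique D≡Δ ⟩
  suc (n * 2) ^ length D  ≤⟨ ^-monoˡ-≤ (length D) (1+n*2≤n*n 2<n) ⟩
  (n * n) ^ length D      ≡⟨ cong (λ m → (n * m) ^ length D) (*-identityʳ n) ⟨
  (n ^ 2) ^ length D      ≡⟨ ^-*-assoc n 2 (length D) ⟩
  n ^ (2 * length D)      ∎
  where open ≤-Reasoning
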